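{- Let $G\in\mathrm{Mat}_{k\times n}(\mathbb{Z})$ have no zero column, with lcm period $\rho_0$. For every $m\in\{1,\dots,\rho_0\}$, $\deg f^m_{d'_m}(t)\le 1$.
   Context: $E=\{1,\dots,n\}$. For nonempty $J\subseteq E$, $r(J)$ is the rank of the submatrix $G_J$ of columns indexed by $J$ and $e_{1,J}\mid\cdots\mid e_{r(J),J}$ its elementary divisors; $r(\emptyset)=0$; empty products equal $1$. $\rho_0:=\mathrm{lcm}(e_{r(J),J}\mid\emptyset\ne J\subseteq E)$. For $m\in\{1,\dots,\rho_0\}$ and $i\in\{0,\dots,n\}$, $$f_i^m(t):=\sum_{J\subseteq E,\ |J|=n-i}\ \sum_{K:\,J\subseteq K\subseteq E}(-1)^{|K|-|J|}\frac{\prod_{\ell=1}^{r(K)}\gcd(m,e_{\ell,K})}{\prod_{\ell=1}^{r(E)}\gcd(m,e_{\ell,E})}\,t^{r(E)-r(K)}\in\mathbb{Q}[t],$$ and $d'_m:=\min\{i\in\mathbb{Z}_{>0}\mid f_i^m(t)\ne0 \text{ as a polynomial}\}$. -}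

module Defs where

open import Data.Bool using (Bool; true; false; if_then_else_)
open import Data.Nat.Divisibility using (_∣_)
open import Data.Nat as ℕ using (ℕ; zero; suc; _<_; _≤_; _≡ᵇ_; _≤ᵇ_)
open import Data.Nat.GCD using (gcd)
open import Data.Nat.LCM using (lcm)
open import Data.Integer as ℤ using (ℤ; +_)
open import Data.Rational as ℚ using (ℚ; 0ℚ; 1ℚ)
open import Data.Fin using (Fin; zero; suc; toℕ)
open import Data.Fin.Subset using (Subset; ∣_∣; ⊤; inside; outside)
open import Data.Fin.Subset.Properties using (_⊆?_)
open import Data.Vec as Vec using (Vec; []; _∷_)
open import Data.List as List using (List; []; _∷_; length; map; filterᵇ; concatMap)
open import Data.Product using (Σ; _×_; ∃)
open import Relation.Binary.PropositionalEquality using (_≡_)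
open import Relation.Nullary.Decidable using (does)

Matrix : ℕ → ℕ → Set
Matrix r c = Fin r → Fin c → ℤ

∑ℤ : ∀ {n} → (Fin n → ℤ) → ℤ
∑ℤ {zero}  f = + 0
∑ℤ {suc n} f = f zero ℤ.+ ∑ℤ (λ i → f (suc i))

infixl 7 _⊗_
_⊗_ : ∀ {a b c} → Matrix a b → Matrix b c → Matrix a c
(A ⊗ B) i j = ∑ℤ (λ l → A i l ℤ.* B l j)

idMat : ∀ {n} → Matrix n n
idMat i j = if toℕ i ≡ᵇ toℕ j then + 1 else + 0

Unimodular : ∀ {n} → Matrix n n → Set
Unimodular {n} U = Σ (Matrix n n) λ W →
  (∀ i j → (U ⊗ W) i j ≡ idMat i j) × (∀ i j → (W ⊗ U) i j ≡ idMat i j)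

nth : List ℕ → ℕ → ℕ
nth []       _       = 0
nth (x ∷ _)  zero    = x
nth (_ ∷ xs) (suc ℓ) = nth xs ℓ

diagMat : ∀ r c → List ℕ → Matrix r c
diagMat r c es i j = if toℕ i ≡ᵇ toℕ j then + nth es (toℕ i) else + 0

-- es = (e₁ ∣ e₂ ∣ ⋯ ∣ e_r), all positive, are the (nonzero) elementary
-- divisors of A: A has Smith normal form diag(e₁,…,e_r,0,…,0).
-- The number r = length es is the rank of A.
IsSmithForm : ∀ {r c} → Matrix r c → List ℕ → Set
IsSmithForm {r} {c} A es =
  length es ≤ r × length es ≤ c ×
  (∀ ℓ → ℓ < length es → 0 < nth es ℓ) ×
  (∀ ℓ → suc ℓ < length es → nth es ℓ ∣ nth es (suc ℓ)) ×
  Σ (Matrix r r) λ U → Σ (Matrix c c) λ V →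
    Unimodular U × Unimodular V × (∀ i j → (U ⊗ A ⊗ V) i j ≡ diagMat r c es i j)

subsets : (n : ℕ) → List (Subset n)
subsets zero    = [] ∷ []
subsets (suc n) = concatMap (λ J → (outside ∷ J) ∷ (inside ∷ J) ∷ []) (subsets n)

members : ∀ {n} → Subset n → List (Fin n)
members []              = []
members (outside ∷ J)   = map suc (members J)
members (inside ∷ J)    = zero ∷ map suc (members J)

subMat : ∀ {k n} → Matrix k n → (J : Subset n) → Matrix k (length (members J))
subMat G J i j = G i (List.lookup (members J) j)

-- The quantities of the paper, given the elementary-divisor data
-- ed J = (e_{1,J}, …, e_{r(J),J})

rk : ∀ {n} → (Subset n → List ℕ) → Subset n → ℕ
rk ed J = length (ed J)

lastD : List ℕ → ℕ
lastD []           = 1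
lastD (x ∷ [])     = x
lastD (_ ∷ y ∷ ys) = lastD (y ∷ ys)

ρ₀ : ∀ n → (Subset n → List ℕ) → ℕ
ρ₀ n ed = List.foldr lcm 1 (map (λ J → lastD (ed J)) (filterᵇ (λ J → 1 ≤ᵇ ∣ J ∣) (subsets n)))

prodℕ : List ℕ → ℕ
prodℕ = List.foldr ℕ._*_ 1

sumℚ : List ℚ → ℚ
sumℚ = List.foldr ℚ._+_ 0ℚ

-- a / b in ℚ (b = 0 never occurs below since m ≥ 1; convention a/0 = 0)
frac : ℕ → ℕ → ℚ
frac a zero    = 0ℚ
frac a (suc b) = (+ a) ℚ./ suc b

negOnePow : ℕ → ℚ
negOnePow zero    = 1ℚ
negOnePow (suc a) = ℚ.- negOnePow a

Poly : Set
Poly = ℕ → ℚ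

IsZeroPoly : Poly → Set
IsZeroPoly p = ∀ d → p d ≡ 0ℚ

DegLe1 : Poly → Set
DegLe1 p = ∀ d → 2 ≤ d → p d ≡ 0ℚ

gprod : ∀ {n} → (Subset n → List ℕ) → ℕ → Subset n → ℕ
gprod ed m K = prodℕ (map (gcd m) (ed K))

f : ∀ n → (Subset n → List ℕ) → (m i : ℕ) → Poly
f n ed m i d =
  sumℚ (map (λ J →
    sumℚ (map (λ K →
      if (rk ed ⊤ ℕ.∸ rk ed K) ≡ᵇ d
      then negOnePow (∣ K ∣ ℕ.∸ ∣ J ∣) ℚ.* frac (gprod ed m K) (gprod ed m ⊤)
      else 0ℚ)
      (filterᵇ (λ K → does (J ⊆? K)) (subsets n))))
    (filterᵇ (λ J → (∣ J ∣ ℕ.+ i) ≡ᵇ n) (subsets n)))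

{-# OPTIONS --safe #-}
module Submission where

-- Adding one column to an integer matrix raises its rank by at most one: in Smith coordinates
-- the kernel of G_K is cut out by r(K) coordinate conditions, so if r(K ∪ {e}) ≥ r(K) + 2 an
-- underdetermined homogeneous system yields a kernel vector of G_{K ∪ {e}} that its Smith form
-- forbids. Consequently, if all column sets of size ≥ n − j have full rank r(E), those of size
-- n − j − 1 have corank ≤ 1, and the coefficient of t in f_{j+1}^m is a sum of non-negative
-- terms ∏ gcd(m, e_{ℓ,J}) / ∏ gcd(m, e_{ℓ,E}), one for each J of size n − j − 1 and corank 1.
-- So f_{j+1}^m = 0 forces those J to have full rank too. By induction, below i = d′_m every
-- K ⊇ J with |J| = n − i has corank ≤ 1, which bounds the degree of f_i^m by 1.

open import Defs
open import Data.Bool using (true; false; if_then_else_; T)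
open import Data.Empty using (⊥-elim)
open import Data.Fin using (Fin; zero; suc; toℕ; punchIn; punchOut; fromℕ<; inject≤)
import Data.Fin.Properties as FinP
open import Data.Fin.Subset using (Subset; ∣_∣; ⊤; inside; outside; _⊆_)
open import Data.Fin.Subset.Properties using (_⊆?_; ⊆-refl; drop-∷-⊆; p⊆q⇒∣p∣≤∣q∣; ∣p∣≤n; ∣p∣≡n⇒p≡⊤)
open import Data.Integer as ℤ using (ℤ; +_; _+_; _*_; -_; _-_)
import Data.Integer.Properties as ℤP
open import Algebra.Properties.Semiring.Sum ℤP.+-*-semiring
  using (sum; sum-cong-≗; sum-remove; sum-replicate-zero; ∑-comm; ∑-distrib-+; *-distribˡ-sum; *-distribʳ-sum)
open import Data.Integer.Tactic.RingSolver using (solve-∀)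
open import Data.List as List using (List; []; _∷_; length; filterᵇ)
open import Data.List.Membership.Propositional using (_∈_)
open import Data.List.Membership.Propositional.Properties using (∈-filter⁺; ∈-filter⁻; ∈-concatMap⁺)
open import Data.List.Relation.Unary.Any as Any using (here; there)
open import Data.Nat as ℕ using (ℕ; zero; suc; _≡ᵇ_; _<_; _≤_; _∸_; s≤s; z≤n)
import Data.Nat.Properties as ℕP
open import Data.Nat.GCD using (gcd; gcd[m,n]≢0)
open import Data.Product using (∃; ∃-syntax; _×_; _,_; proj₁; proj₂)
open import Data.Rational as ℚ using (ℚ; 0ℚ; 1ℚ)
import Data.Rational.Properties as ℚP
open import Data.Sum as Sum using (_⊎_; inj₁; inj₂; [_,_]′)
open import Data.Vec as Vec using ([]; _∷_)
open import Function using (_∘_; id; _⇔_; mk⇔; Equivalence)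
open import Relation.Binary.PropositionalEquality
open import Relation.Nullary using (¬_; ¬?; yes; no; does; contradiction)
open import Relation.Nullary.Decidable using (dec-true; dec-false; decidable-stable; T?)

if-≡ᵇ-yes : ∀ {A : Set} {m n} {x y : A} → m ≡ n → (if m ≡ᵇ n then x else y) ≡ x
if-≡ᵇ-yes {m = m} {n} {x} {y} eq = cong (if_then x else y) (dec-true (m ℕ.≟ n) eq)

if-≡ᵇ-no : ∀ {A : Set} {m n} {x y : A} → m ≢ n → (if m ≡ᵇ n then x else y) ≡ y
if-≡ᵇ-no {m = m} {n} {x} {y} ne = cong (if_then x else y) (dec-false (m ℕ.≟ n) ne)

sum-zero : ∀ {n} {g : Fin n → ℤ} → (∀ j → g j ≡ + 0) → sum g ≡ + 0
sum-zero {n} vanish = trans (sum-cong-≗ vanish) (sum-replicate-zero n)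

sum-single : ∀ {n} (g : Fin n → ℤ) (j : Fin n) → (∀ j′ → j′ ≢ j → g j′ ≡ + 0) → sum g ≡ g j
sum-single {suc n} g j vanish = begin
  sum g                          ≡⟨ sum-remove g ⟩
  g j + sum (g ∘ punchIn j)      ≡⟨ cong (_+_ (g j)) (sum-zero (λ j′ → vanish _ (FinP.punchInᵢ≢i j j′))) ⟩
  g j + + 0                      ≡⟨ ℤP.+-identityʳ (g j) ⟩
  g j                            ∎
  where open ≡-Reasoning

infixr 8 _·_
_·_ : ∀ {a b} → Matrix a b → (Fin b → ℤ) → Fin a → ℤ
(M · x) i = sum (λ j → M i j * x j)

∑ℤ≡sum : ∀ {n} (g : Fin n → ℤ) → ∑ℤ g ≡ sum g
∑ℤ≡sum {zero}  g = refl
∑ℤ≡sum {suc n} g = cong (_+_ (g zero)) (∑ℤ≡sum (g ∘ suc))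

·-congˡ : ∀ {a b} {M N : Matrix a b} → (∀ i j → M i j ≡ N i j) → ∀ x i → (M · x) i ≡ (N · x) i
·-congˡ M≡N x i = sum-cong-≗ (λ j → cong (_* x j) (M≡N i j))

·-congʳ : ∀ {a b} (M : Matrix a b) {x y : Fin b → ℤ} → (∀ j → x j ≡ y j) → ∀ i → (M · x) i ≡ (M · y) i
·-congʳ M x≡y i = sum-cong-≗ (λ j → cong (M i j *_) (x≡y j))

·-zeroʳ : ∀ {a b} (M : Matrix a b) {x : Fin b → ℤ} → (∀ j → x j ≡ + 0) → ∀ i → (M · x) i ≡ + 0
·-zeroʳ M x≡0 i = sum-zero (λ j → trans (cong (M i j *_) (x≡0 j)) (ℤP.*-zeroʳ (M i j)))

·-assoc : ∀ {a b c} (M : Matrix a b) (N : Matrix b c) (x : Fin c → ℤ) i →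
  ((M ⊗ N) · x) i ≡ (M · (N · x)) i
·-assoc M N x i = begin
  sum (λ j → ∑ℤ (λ l → M i l * N l j) * x j)
    ≡⟨ sum-cong-≗ (λ j → cong (_* x j) (∑ℤ≡sum (λ l → M i l * N l j))) ⟩
  sum (λ j → sum (λ l → M i l * N l j) * x j)
    ≡⟨ sum-cong-≗ (λ j → *-distribʳ-sum (x j) (λ l → M i l * N l j)) ⟩
  sum (λ j → sum (λ l → M i l * N l j * x j))
    ≡⟨ ∑-comm (λ j l → M i l * N l j * x j) ⟩
  sum (λ l → sum (λ j → M i l * N l j * x j))
    ≡⟨ sum-cong-≗ (λ l → sum-cong-≗ (λ j → ℤP.*-assoc (M i l) (N l j) (x j))) ⟩
  sum (λ l → sum (λ j → M i l * (N l j * x j)))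
    ≡⟨ sum-cong-≗ (λ l → *-distribˡ-sum (M i l) (λ j → N l j * x j)) ⟨
  (M · (N · x)) i
    ∎
  where open ≡-Reasoning

-- diagMat r c es and idMat are definitionally instances of diagonal.
diagonal : ∀ {a b} → (ℕ → ℤ) → Matrix a b
diagonal d i j = if toℕ i ≡ᵇ toℕ j then d (toℕ i) else + 0

·-diagonal : ∀ {a b} (d : ℕ → ℤ) (x : Fin b → ℤ) {i : Fin a} {j : Fin b} → toℕ i ≡ toℕ j →
  (diagonal d · x) i ≡ d (toℕ i) * x j
·-diagonal d x {i} {j} i≈j = begin
  (diagonal d · x) i       ≡⟨ sum-single (λ j′ → diagonal d i j′ * x j′) j off-diagonal ⟩
  diagonal d i j * x j     ≡⟨ cong (_* x j) (if-≡ᵇ-yes i≈j) ⟩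
  d (toℕ i) * x j          ∎
  where
  open ≡-Reasoning
  off-diagonal : ∀ j′ → j′ ≢ j → diagonal d i j′ * x j′ ≡ + 0
  off-diagonal j′ j′≢j =
    trans (cong (_* x j′) (if-≡ᵇ-no (λ i≈j′ → j′≢j (FinP.toℕ-injective (trans (sym i≈j′) i≈j)))))
          (ℤP.*-zeroˡ (x j′))

kronecker : ∀ {a b} → Matrix a b
kronecker = diagonal (λ _ → + 1)

·-kronecker : ∀ {a b} (x : Fin b → ℤ) {i : Fin a} {j : Fin b} → toℕ i ≡ toℕ j → (kronecker · x) i ≡ x j
·-kronecker x i≈j = trans (·-diagonal (λ _ → + 1) x i≈j) (ℤP.*-identityˡ _)

·-inverse : ∀ {n} (W U : Matrix n n) → (∀ i j → (W ⊗ U) i j ≡ idMat i j) → ∀ y i → (W · (U · y)) i ≡ y i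
·-inverse W U W⊗U≡I y i = begin
  (W · (U · y)) i     ≡⟨ ·-assoc W U y i ⟨
  ((W ⊗ U) · y) i     ≡⟨ ·-congˡ W⊗U≡I y i ⟩
  (idMat · y) i       ≡⟨ ·-kronecker y refl ⟩
  y i                 ∎
  where open ≡-Reasoning

NonZeroVec : ∀ {r} → (Fin r → ℤ) → Set
NonZeroVec w = ∃[ j ] w j ≢ + 0

unitVec₀ : ∀ {r} → Fin (suc r) → ℤ
unitVec₀ zero    = + 1
unitVec₀ (suc _) = + 0

module Elimination {s r} (M : Matrix (suc s) (suc r)) (t : Fin (suc s)) where

  pivot : ℤ
  pivot = M t zero

  eliminated : Matrix s r
  eliminated u j = pivot * M (punchIn t u) (suc j) - M (punchIn t u) zero * M t (suc j)

  lift : (Fin r → ℤ) → Fin (suc r) → ℤ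
  lift w zero    = - sum (λ j → M t (suc j) * w j)
  lift w (suc j) = pivot * w j

  row·lift : ∀ (row : Fin (suc r) → ℤ) w →
    sum (λ j → row j * lift w j) ≡ sum (λ j → (pivot * row (suc j) - row zero * M t (suc j)) * w j)
  row·lift row w = begin
    row zero * (- S) + sum (λ j → row (suc j) * (pivot * w j))
      ≡⟨ cong (_+_ (row zero * (- S))) (trans (sum-cong-≗ (λ j → swap-pivot (row (suc j)) pivot (w j)))
                                               (sym (*-distribˡ-sum pivot (λ j → row (suc j) * w j)))) ⟩
    row zero * (- S) + pivot * X
      ≡⟨ regroup (row zero) S pivot X ⟩
    pivot * X + (- row zero) * S
      ≡⟨ cong₂ _+_ (*-distribˡ-sum pivot (λ j → row (suc j) * w j))
                   (*-distribˡ-sum (- row zero) (λ j → M t (suc j) * w j)) ⟩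
    sum (λ j → pivot * (row (suc j) * w j)) + sum (λ j → (- row zero) * (M t (suc j) * w j))
      ≡⟨ ∑-distrib-+ (λ j → pivot * (row (suc j) * w j)) (λ j → (- row zero) * (M t (suc j) * w j)) ⟨
    sum (λ j → pivot * (row (suc j) * w j) + (- row zero) * (M t (suc j) * w j))
      ≡⟨ sum-cong-≗ (λ j → expand pivot (row (suc j)) (row zero) (M t (suc j)) (w j)) ⟨
    sum (λ j → (pivot * row (suc j) - row zero * M t (suc j)) * w j) ∎
    where
    open ≡-Reasoning
    S = sum (λ j → M t (suc j) * w j)
    X = sum (λ j → row (suc j) * w j)
    swap-pivot : ∀ a p x → a * (p * x) ≡ p * (a * x)
    swap-pivot = solve-∀
    regroup : ∀ a s p x → a * (- s) + p * x ≡ p * x + (- a) * s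
    regroup = solve-∀
    expand : ∀ p b a c x → (p * b - a * c) * x ≡ p * (b * x) + (- a) * (c * x)
    expand = solve-∀

  pivot-row-vanishes : ∀ w → sum (λ j → M t j * lift w j) ≡ + 0
  pivot-row-vanishes w = trans (row·lift (M t) w)
    (sum-zero (λ j → trans (cong (_* w j) (ℤP.+-inverseʳ (pivot * M t (suc j)))) (ℤP.*-zeroˡ (w j))))

  lift-solves : ∀ w → (∀ u → (eliminated · w) u ≡ + 0) → ∀ t′ → (M · lift w) t′ ≡ + 0
  lift-solves w sol t′ with t′ FinP.≟ t
  ... | yes refl = pivot-row-vanishes w
  ... | no t′≢t = begin
    (M · lift w) t′                          ≡⟨ cong (λ v → (M · lift w) v) (FinP.punchIn-punchOut t≢t′) ⟨
    (M · lift w) (punchIn t (punchOut t≢t′)) ≡⟨ row·lift (M (punchIn t (punchOut t≢t′))) w ⟩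
    (eliminated · w) (punchOut t≢t′)         ≡⟨ sol (punchOut t≢t′) ⟩
    + 0                                      ∎
    where
    open ≡-Reasoning
    t≢t′ = t′≢t ∘ sym

homogeneous-nontrivial : ∀ {s r} (M : Matrix s r) → s < r →
  ∃[ w ] NonZeroVec w × (∀ i → (M · w) i ≡ + 0)
homogeneous-nontrivial {zero} {suc r} M _ = unitVec₀ , (zero , λ ()) , λ ()
homogeneous-nontrivial {suc s} {suc r} M (s≤s s<r) with FinP.any? (λ t → ¬? (M t zero ℤP.≟ + 0))
... | no no-pivot = unitVec₀ , (zero , λ ()) , first-column-solves
  where
  first-column-solves : ∀ t → (M · unitVec₀) t ≡ + 0
  first-column-solves t = begin
    (M · unitVec₀) t     ≡⟨ sum-single (λ j → M t j * unitVec₀ j) zero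
                              (λ { zero 0≢0 → contradiction refl 0≢0 ; (suc j) _ → ℤP.*-zeroʳ (M t (suc j)) }) ⟩
    M t zero * + 1       ≡⟨ ℤP.*-identityʳ (M t zero) ⟩
    M t zero             ≡⟨ decidable-stable (M t zero ℤP.≟ + 0) (λ Mt0≢0 → no-pivot (t , Mt0≢0)) ⟩
    + 0                  ∎
    where open ≡-Reasoning
... | yes (t , pivot≢0) with homogeneous-nontrivial (Elimination.eliminated M t) s<r
... | w , (j , wj≢0) , sol = lift w , (suc j , pivot*wj≢0) , lift-solves w sol
  where
  open Elimination M t
  pivot*wj≢0 : pivot * w j ≢ + 0
  pivot*wj≢0 = [ pivot≢0 , wj≢0 ]′ ∘ ℤP.i*j≡0⇒i≡0∨j≡0 pivot

nth-beyond : ∀ xs {ℓ} → length xs ≤ ℓ → nth xs ℓ ≡ 0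
nth-beyond []       _         = refl
nth-beyond (_ ∷ xs) (s≤s len≤ℓ) = nth-beyond xs len≤ℓ

diagMat·-vanishes : ∀ {k c} es {z : Fin c → ℤ} → (∀ j → toℕ j < length es → z j ≡ + 0) →
  ∀ i → (diagMat k c es · z) i ≡ + 0
diagMat·-vanishes {k} {c} es {z} z-low i = sum-zero term
  where
  term : ∀ j → diagMat k c es i j * z j ≡ + 0
  term j with toℕ i ℕ.≟ toℕ j | toℕ j ℕ.<? length es
  ... | no i≉j  | _       = trans (cong (_* z j) (if-≡ᵇ-no i≉j)) (ℤP.*-zeroˡ (z j))
  ... | yes _   | yes low = trans (cong (diagMat k c es i j *_) (z-low j low))
                                  (ℤP.*-zeroʳ (diagMat k c es i j))
  ... | yes i≈j | no high = trans (cong (_* z j) (trans (if-≡ᵇ-yes i≈j) (cong +_ (nth-beyond es beyond))))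
                                  (ℤP.*-zeroˡ (z j))
    where
    beyond : length es ≤ toℕ i
    beyond = subst (length es ≤_) (sym i≈j) (ℕP.≮⇒≥ high)

diagMat·-kernel : ∀ {k c} es → length es ≤ k → (∀ ℓ → ℓ < length es → 0 < nth es ℓ) →
  ∀ {z : Fin c → ℤ} → (∀ i → (diagMat k c es · z) i ≡ + 0) → ∀ j → toℕ j < length es → z j ≡ + 0
diagMat·-kernel {k} {c} es r≤k positive {z} Dz≡0 j low =
  [ (λ e≡0 → contradiction (ℤP.+-injective e≡0) (ℕP.>⇒≢ e>0)) , id ]′ (ℤP.i*j≡0⇒i≡0∨j≡0 _ eq)
  where
  i : Fin k
  i = fromℕ< (ℕP.<-≤-trans low r≤k)
  i≈j : toℕ i ≡ toℕ j
  i≈j = FinP.toℕ-fromℕ< _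
  e>0 : 0 < nth es (toℕ i)
  e>0 = positive (toℕ i) (subst (_< length es) (sym i≈j) low)
  eq : + nth es (toℕ i) * z j ≡ + 0
  eq = trans (sym (·-diagonal (λ ℓ → + nth es ℓ) z i≈j)) (Dz≡0 i)

smith-null-space : ∀ {k c} {A : Matrix k c} {es} → IsSmithForm A es →
  ∃[ V ] Unimodular V × (∀ z → (∀ i → (A · (V · z)) i ≡ + 0) ⇔ (∀ j → toℕ j < length es → z j ≡ + 0))
smith-null-space {k} {c} {A} {es}
  (r≤k , _ , positive , _ , U , V , (W , _ , W⊗U≡I) , V-unimodular , U⊗A⊗V≡D) =
  V , V-unimodular , λ z → mk⇔ (kernel⇒low z) (low⇒kernel z)
  where
  D· : ∀ z i → (diagMat k c es · z) i ≡ (U · (A · (V · z))) i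
  D· z i = begin
    (diagMat k c es · z) i    ≡⟨ ·-congˡ U⊗A⊗V≡D z i ⟨
    ((U ⊗ A ⊗ V) · z) i       ≡⟨ ·-assoc (U ⊗ A) V z i ⟩
    ((U ⊗ A) · (V · z)) i     ≡⟨ ·-assoc U A (V · z) i ⟩
    (U · (A · (V · z))) i     ∎
    where open ≡-Reasoning

  kernel⇒low : ∀ z → (∀ i → (A · (V · z)) i ≡ + 0) → ∀ j → toℕ j < length es → z j ≡ + 0
  kernel⇒low z AVz≡0 = diagMat·-kernel es r≤k positive (λ i → trans (D· z i) (·-zeroʳ U AVz≡0 i))

  low⇒kernel : ∀ z → (∀ j → toℕ j < length es → z j ≡ + 0) → ∀ i → (A · (V · z)) i ≡ + 0
  low⇒kernel z z-low i = begin
    (A · (V · z)) i                 ≡⟨ ·-inverse W U W⊗U≡I (A · (V · z)) i ⟨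
    (W · (U · (A · (V · z)))) i     ≡⟨ ·-zeroʳ W UAVz≡0 i ⟩
    + 0                             ∎
    where
    open ≡-Reasoning
    UAVz≡0 : ∀ i′ → (U · (A · (V · z))) i′ ≡ + 0
    UAVz≡0 i′ = trans (sym (D· z i′)) (diagMat·-vanishes es z-low i′)

module ColumnInsertion {k a c} (A : Matrix k a) (A′ : Matrix k c) (τ : Fin c) (σ : Fin a → Fin c)
  (restrict : ∀ u → u τ ≡ + 0 → ∀ i → (A′ · u) i ≡ (A · (u ∘ σ)) i)
  {r} (r≤a : r ≤ a) (V Vi : Matrix a a) (V⊗Vi≡I : ∀ i j → (V ⊗ Vi) i j ≡ idMat i j)
  (low⇒kernel : ∀ z → (∀ j → toℕ j < r → z j ≡ + 0) → ∀ i → (A · (V · z)) i ≡ + 0) where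

  select : Matrix a c
  select i = kronecker (σ i)

  conditions : ∀ {b} → Matrix c b → Matrix (suc r) b
  conditions B zero    = B τ
  conditions B (suc ℓ) = (Vi ⊗ select ⊗ B) (inject≤ ℓ r≤a)

  conditions⇒kernel : ∀ {b} (B : Matrix c b) w → (∀ l → (conditions B · w) l ≡ + 0) →
    ∀ i → (A′ · (B · w)) i ≡ + 0
  conditions⇒kernel B w solves i = trans (restrict u (solves zero) i) (begin
    (A · (u ∘ σ)) i               ≡⟨ ·-congʳ A (·-inverse V Vi V⊗Vi≡I (u ∘ σ)) i ⟨
    (A · (V · (Vi · (u ∘ σ)))) i  ≡⟨ low⇒kernel (Vi · (u ∘ σ)) Vi·u∘σ-low i ⟩
    + 0                           ∎)
    where
    open ≡-Reasoning
    u = B · w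

    Vi·u∘σ-low : ∀ l → toℕ l < r → (Vi · (u ∘ σ)) l ≡ + 0
    Vi·u∘σ-low l low = begin
      (Vi · (u ∘ σ)) l             ≡⟨ cong (Vi · (u ∘ σ)) l′≡l ⟨
      (Vi · (u ∘ σ)) l′            ≡⟨ ·-congʳ Vi (λ i → ·-kronecker u refl) l′ ⟨
      (Vi · (select · u)) l′       ≡⟨ ·-assoc Vi select u l′ ⟨
      ((Vi ⊗ select) · u) l′       ≡⟨ ·-assoc (Vi ⊗ select) B w l′ ⟨
      (conditions B · w) (suc ℓ)   ≡⟨ solves (suc ℓ) ⟩
      + 0                          ∎
      where
      ℓ = fromℕ< low
      l′ = inject≤ ℓ r≤a
      l′≡l : l′ ≡ l
      l′≡l = FinP.toℕ-injective (trans (FinP.toℕ-inject≤ ℓ r≤a) (FinP.toℕ-fromℕ< low))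

-- If r(A′) ≥ r(A) + 2, the r(A) + 1 rows of conditions (V′ ⊗ pad) admit a nontrivial solution w,
-- so V′ (w, 0, …, 0) lies in the kernel of A′; in the Smith coordinates of A′ this forces w = 0.
rank-insert-column : ∀ {k a c} {A : Matrix k a} {A′ : Matrix k c} {es es′} (τ : Fin c) (σ : Fin a → Fin c) →
  (∀ u → u τ ≡ + 0 → ∀ i → (A′ · u) i ≡ (A · (u ∘ σ)) i) →
  IsSmithForm A es → IsSmithForm A′ es′ → length es′ ≤ suc (length es)
rank-insert-column {A = A} {A′} {es} {es′} τ σ restrict smith smith′
  with length es′ ℕ.≤? suc (length es)
     | smith-null-space {A = A} {es} smith
     | smith-null-space {A = A′} {es′} smith′
... | yes r′≤1+r | _ | _ = r′≤1+r
... | no r′≰1+r | V , (Vi , V⊗Vi≡I , _) , null | V′ , _ , null′ =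
  ⊥-elim (no-nontrivial-solution (homogeneous-nontrivial (conditions B) (ℕP.≰⇒> r′≰1+r)))
  where
  open ColumnInsertion A A′ τ σ restrict (proj₁ (proj₂ smith)) V Vi V⊗Vi≡I (Equivalence.from ∘ null)
  r′≤c = proj₁ (proj₂ smith′)
  pad = kronecker
  B = V′ ⊗ pad

  no-nontrivial-solution : ¬ (∃[ w ] NonZeroVec w × (∀ l → (conditions B · w) l ≡ + 0))
  no-nontrivial-solution (w , (j , wj≢0) , solves) = wj≢0 (begin
    w j                 ≡⟨ ·-kronecker w j′≈j ⟨
    (pad · w) j′        ≡⟨ Equivalence.to (null′ (pad · w)) A′·V′·pad·w j′ j′-low ⟩
    + 0                 ∎)
    where
    open ≡-Reasoning
    j′ = inject≤ j r′≤c
    j′≈j : toℕ j′ ≡ toℕ j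
    j′≈j = FinP.toℕ-inject≤ j r′≤c
    j′-low : toℕ j′ < length es′
    j′-low = subst (_< length es′) (sym j′≈j) (FinP.toℕ<n j)
    A′·V′·pad·w : ∀ i → (A′ · (V′ · (pad · w))) i ≡ + 0
    A′·V′·pad·w i = trans (·-congʳ A′ (λ l → sym (·-assoc V′ pad w l)) i) (conditions⇒kernel B w solves i)

data Insertion {A : Set} (x : A) : List A → List A → Set where
  here  : ∀ {L} → Insertion x L (x ∷ L)
  there : ∀ {y L L′} → Insertion x L L′ → Insertion x (y ∷ L) (y ∷ L′)

insertion-map : ∀ {A B : Set} (g : A → B) {x L L′} →
  Insertion x L L′ → Insertion (g x) (List.map g L) (List.map g L′)
insertion-map g here      = here
insertion-map g (there p) = there (insertion-map g p)

position : ∀ {A : Set} {x : A} {L L′} → Insertion x L L′ → Fin (length L′)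
position here      = zero
position (there p) = suc (position p)

embedding : ∀ {A : Set} {x : A} {L L′} → Insertion x L L′ → Fin (length L) → Fin (length L′)
embedding here      j       = suc j
embedding (there p) zero    = zero
embedding (there p) (suc j) = suc (embedding p j)

sum-insertion : ∀ {A : Set} {x : A} {L L′} (p : Insertion x L L′) (g : A → ℤ) (u : Fin (length L′) → ℤ) →
  u (position p) ≡ + 0 →
  sum (λ j → g (List.lookup L′ j) * u j) ≡ sum (λ j → g (List.lookup L j) * u (embedding p j))
sum-insertion {x = x} {L} here g u u₀≡0 = begin
  g x * u zero + S     ≡⟨ cong (λ v → g x * v + S) u₀≡0 ⟩
  g x * + 0 + S        ≡⟨ cong (_+ S) (ℤP.*-zeroʳ (g x)) ⟩
  + 0 + S              ≡⟨ ℤP.+-identityˡ S ⟩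
  S                    ∎
  where
  open ≡-Reasoning
  S = sum (λ j → g (List.lookup L j) * u (suc j))
sum-insertion {L = y ∷ _} (there p) g u uₚ≡0 = cong (_+_ (g y * u zero)) (sum-insertion p g (u ∘ suc) uₚ≡0)

insert-element : ∀ {n} (K : Subset n) → ∣ K ∣ < n →
  ∃[ K′ ] ∣ K′ ∣ ≡ suc ∣ K ∣ × ∃[ e ] Insertion e (members K) (members K′)
insert-element (outside ∷ K) _ = inside ∷ K , refl , zero , here
insert-element (inside ∷ K) (s≤s |K|<n) with insert-element K |K|<n
... | K′ , |K′|≡1+|K| , e , p = inside ∷ K′ , cong suc |K′|≡1+|K| , suc e , there (insertion-map suc p)

rank-insert-element : ∀ {k n} (G : Matrix k n) (ed : Subset n → List ℕ) →
  (∀ J → IsSmithForm (subMat G J) (ed J)) →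
  ∀ K → ∣ K ∣ < n → ∃[ K′ ] ∣ K′ ∣ ≡ suc ∣ K ∣ × rk ed K′ ≤ suc (rk ed K)
rank-insert-element G ed smith K |K|<n with insert-element K |K|<n
... | K′ , |K′|≡1+|K| , _ , p =
  K′ , |K′|≡1+|K| ,
  rank-insert-column {A = subMat G K} {subMat G K′} {ed K} {ed K′} (position p) (embedding p)
    (λ u uₚ≡0 i → sum-insertion p (G i) u uₚ≡0) (smith K) (smith K′)

sumℚ-zero : ∀ {A : Set} (g : A → ℚ) xs → (∀ x → x ∈ xs → g x ≡ 0ℚ) → sumℚ (List.map g xs) ≡ 0ℚ
sumℚ-zero g []       _     = refl
sumℚ-zero g (x ∷ xs) g≡0 =
  trans (cong₂ ℚ._+_ (g≡0 x (here refl)) (sumℚ-zero g xs (λ y → g≡0 y ∘ there))) (ℚP.+-identityʳ 0ℚ)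

sumℚ-nonneg : ∀ {A : Set} (g : A → ℚ) xs → (∀ x → x ∈ xs → 0ℚ ℚ.≤ g x) → 0ℚ ℚ.≤ sumℚ (List.map g xs)
sumℚ-nonneg g []       _     = ℚP.≤-refl
sumℚ-nonneg g (x ∷ xs) g≥0 = ℚP.+-mono-≤ (g≥0 x (here refl)) (sumℚ-nonneg g xs (λ y → g≥0 y ∘ there))

sumℚ-pos : ∀ {A : Set} (g : A → ℚ) xs → (∀ x → x ∈ xs → 0ℚ ℚ.≤ g x) →
  ∀ {x₀} → x₀ ∈ xs → 0ℚ ℚ.< g x₀ → 0ℚ ℚ.< sumℚ (List.map g xs)
sumℚ-pos g (x ∷ xs) g≥0 (here refl) gx>0 = ℚP.+-mono-<-≤ gx>0 (sumℚ-nonneg g xs (λ y → g≥0 y ∘ there))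
sumℚ-pos g (x ∷ xs) g≥0 (there x₀∈) gx₀>0 =
  ℚP.+-mono-≤-< (g≥0 x (here refl)) (sumℚ-pos g xs (λ y → g≥0 y ∘ there) x₀∈ gx₀>0)

subsets-complete : ∀ {n} (K : Subset n) → K ∈ subsets n
subsets-complete []            = here refl
subsets-complete (outside ∷ K) = ∈-concatMap⁺ _ (Any.map (λ { refl → here refl }) (subsets-complete K))
subsets-complete (inside ∷ K)  = ∈-concatMap⁺ _ (Any.map (λ { refl → there (here refl) }) (subsets-complete K))

p⊆q⇒p≡q⊎∣p∣<∣q∣ : ∀ {n} {p q : Subset n} → p ⊆ q → p ≡ q ⊎ ∣ p ∣ < ∣ q ∣
p⊆q⇒p≡q⊎∣p∣<∣q∣ {p = []}          {[]}          _   = inj₁ refl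
p⊆q⇒p≡q⊎∣p∣<∣q∣ {p = inside ∷ p}  {outside ∷ q} p⊆q with () ← p⊆q Vec.here
p⊆q⇒p≡q⊎∣p∣<∣q∣ {p = inside ∷ p}  {inside ∷ q}  p⊆q =
  Sum.map (cong (inside ∷_)) s≤s (p⊆q⇒p≡q⊎∣p∣<∣q∣ (drop-∷-⊆ p⊆q))
p⊆q⇒p≡q⊎∣p∣<∣q∣ {p = outside ∷ p} {outside ∷ q} p⊆q =
  Sum.map₁ (cong (outside ∷_)) (p⊆q⇒p≡q⊎∣p∣<∣q∣ (drop-∷-⊆ p⊆q))
p⊆q⇒p≡q⊎∣p∣<∣q∣ {p = outside ∷ p} {inside ∷ q}  p⊆q = inj₂ (s≤s (p⊆q⇒∣p∣≤∣q∣ (drop-∷-⊆ p⊆q)))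

frac-nonneg : ∀ a b → 0ℚ ℚ.≤ frac a b
frac-nonneg a zero    = ℚP.≤-refl
frac-nonneg a (suc b) = ℚP.nonNegative⁻¹ _ {{ℚP.normalize-nonNeg a (suc b)}}

frac-pos : ∀ {a b} → 0 < a → 0 < b → 0ℚ ℚ.< frac a b
frac-pos {suc a} {suc b} _ _ = ℚP.positive⁻¹ _ {{ℚP.normalize-pos (suc a) (suc b)}}

gcd-prod-pos : ∀ {m} → 0 < m → ∀ es → 0 < prodℕ (List.map (gcd m) es)
gcd-prod-pos _   []       = s≤s z≤n
gcd-prod-pos {m} 0<m (e ∷ es) = ℕP.*-mono-< gcd-pos (gcd-prod-pos 0<m es)
  where
  gcd-pos : 0 < gcd m e
  gcd-pos = ℕP.n≢0⇒n>0 (gcd[m,n]≢0 m e (inj₁ (ℕP.>⇒≢ 0<m)))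

if-nonneg : ∀ b {x} → 0ℚ ℚ.≤ x → 0ℚ ℚ.≤ (if b then x else 0ℚ)
if-nonneg true  x≥0 = x≥0
if-nonneg false _   = ℚP.≤-refl

module Coefficients {n} (ed : Subset n → List ℕ) (m : ℕ) where

  corank : Subset n → ℕ
  corank K = rk ed ⊤ ∸ rk ed K

  level : ℕ → List (Subset n)
  level i = filterᵇ (λ J → (∣ J ∣ ℕ.+ i) ≡ᵇ n) (subsets n)

  supersets : Subset n → List (Subset n)
  supersets J = filterᵇ (λ K → does (J ⊆? K)) (subsets n)

  weight : Subset n → ℚ
  weight K = frac (gprod ed m K) (gprod ed m ⊤)

  term : ℕ → Subset n → Subset n → ℚ
  term d J K = if corank K ≡ᵇ d then negOnePow (∣ K ∣ ∸ ∣ J ∣) ℚ.* weight K else 0ℚ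

  -- f n ed m i d unfolds to sumℚ (List.map (superset-sum d) (level i)).
  superset-sum : ℕ → Subset n → ℚ
  superset-sum d J = sumℚ (List.map (term d J) (supersets J))

  ∈-level⁻ : ∀ {i J} → J ∈ level i → ∣ J ∣ ℕ.+ i ≡ n
  ∈-level⁻ {i} {J} J∈ = ℕP.≡ᵇ⇒≡ _ n (proj₂ (∈-filter⁻ (λ J → T? ((∣ J ∣ ℕ.+ i) ≡ᵇ n)) {xs = subsets n} J∈))

  ∈-level⁺ : ∀ {i} J → ∣ J ∣ ℕ.+ i ≡ n → J ∈ level i
  ∈-level⁺ {i} J eq = ∈-filter⁺ (λ J → T? ((∣ J ∣ ℕ.+ i) ≡ᵇ n)) (subsets-complete J) (ℕP.≡⇒≡ᵇ _ n eq)

  ∈-supersets⁻ : ∀ J {K} → K ∈ supersets J → J ⊆ K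
  ∈-supersets⁻ J {K} K∈ with J ⊆? K | proj₂ (∈-filter⁻ (λ K → T? (does (J ⊆? K))) {xs = subsets n} K∈)
  ... | yes J⊆K | _ = J⊆K

  ∈-supersets⁺ : ∀ {J} K → J ⊆ K → K ∈ supersets J
  ∈-supersets⁺ {J} K J⊆K =
    ∈-filter⁺ (λ K → T? (does (J ⊆? K))) (subsets-complete K) (subst T (sym (dec-true (J ⊆? K) J⊆K)) _)

  term-diagonal : ∀ d J → term d J J ≡ (if corank J ≡ᵇ d then weight J else 0ℚ)
  term-diagonal d J = cong (λ x → if corank J ≡ᵇ d then x else 0ℚ) (begin
    negOnePow (∣ J ∣ ∸ ∣ J ∣) ℚ.* weight J    ≡⟨ cong (λ e → negOnePow e ℚ.* weight J) (ℕP.n∸n≡0 ∣ J ∣) ⟩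
    1ℚ ℚ.* weight J                           ≡⟨ ℚP.*-identityˡ (weight J) ⟩
    weight J                                  ∎)
    where open ≡-Reasoning

  f-coeff-vanishes : ∀ i d → (∀ J K → ∣ J ∣ ℕ.+ i ≡ n → J ⊆ K → corank K ≢ d) → f n ed m i d ≡ 0ℚ
  f-coeff-vanishes i d no-term =
    sumℚ-zero (superset-sum d) (level i) λ J J∈ → sumℚ-zero (term d J) (supersets J) λ K K∈ →
      if-≡ᵇ-no (no-term J K (∈-level⁻ J∈) (∈-supersets⁻ J K∈))

  f-coeff-pos : 0 < m → ∀ i d →
    (∀ J K → ∣ J ∣ ℕ.+ i ≡ n → J ⊆ K → ∣ J ∣ < ∣ K ∣ → corank K ≢ d) →
    ∀ K → ∣ K ∣ ℕ.+ i ≡ n → corank K ≡ d → 0ℚ ℚ.< f n ed m i d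
  f-coeff-pos 0<m i d only-diagonal K K-level K-corank =
    sumℚ-pos (superset-sum d) (level i)
      (λ J J∈ → sumℚ-nonneg (term d J) (supersets J)
                  (λ K′ K′∈ → term-nonneg (∈-level⁻ J∈) (∈-supersets⁻ J K′∈)))
      (∈-level⁺ K K-level)
      (sumℚ-pos (term d K) (supersets K) (λ K′ K′∈ → term-nonneg K-level (∈-supersets⁻ K K′∈))
        (∈-supersets⁺ K ⊆-refl) diagonal-pos)
    where
    term-nonneg : ∀ {J K′} → ∣ J ∣ ℕ.+ i ≡ n → J ⊆ K′ → 0ℚ ℚ.≤ term d J K′
    term-nonneg {J} {K′} J-level J⊆K′ with p⊆q⇒p≡q⊎∣p∣<∣q∣ J⊆K′
    ... | inj₁ refl = subst (0ℚ ℚ.≤_) (sym (term-diagonal d J))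
                        (if-nonneg (corank J ≡ᵇ d) (frac-nonneg (gprod ed m J) (gprod ed m ⊤)))
    ... | inj₂ |J|<|K′| = ℚP.≤-reflexive (sym (if-≡ᵇ-no (only-diagonal J K′ J-level J⊆K′ |J|<|K′|)))
    diagonal-pos : 0ℚ ℚ.< term d K K
    diagonal-pos = subst (0ℚ ℚ.<_) (sym (trans (term-diagonal d K) (if-≡ᵇ-yes K-corank)))
      (frac-pos (gcd-prod-pos 0<m (ed K)) (gcd-prod-pos 0<m (ed ⊤)))

module FullRank {k n} (G : Matrix k n) (ed : Subset n → List ℕ)
                (smith : ∀ J → IsSmithForm (subMat G J) (ed J)) {m} (0<m : 0 < m) where
  open Coefficients ed m

  FullRankFrom : ℕ → Set
  FullRankFrom j = ∀ K → n ≤ ∣ K ∣ ℕ.+ j → corank K ≡ 0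

  full-rank-top : FullRankFrom 0
  full-rank-top K n≤|K|+0 = subst (λ K → corank K ≡ 0) (sym K≡⊤) (ℕP.n∸n≡0 (rk ed ⊤))
    where
    K≡⊤ : K ≡ ⊤
    K≡⊤ = ∣p∣≡n⇒p≡⊤ (ℕP.≤-antisym (∣p∣≤n K) (subst (n ≤_) (ℕP.+-identityʳ ∣ K ∣) n≤|K|+0))

  corank-≤1 : ∀ {j} → FullRankFrom j → ∀ K → n ≤ ∣ K ∣ ℕ.+ suc j → corank K ≤ 1
  corank-≤1 {j} full K n≤|K|+1+j with n ℕP.≤? ∣ K ∣ ℕ.+ j
  ... | yes n≤|K|+j = ℕP.≤-trans (ℕP.≤-reflexive (full K n≤|K|+j)) z≤n
  ... | no n≰|K|+j with rank-insert-element G ed smith K (ℕP.≤-<-trans (ℕP.m≤m+n ∣ K ∣ j) (ℕP.≰⇒> n≰|K|+j))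
  ... | K′ , |K′|≡1+|K| , rk-K′≤1+rk-K =
    ℕP.m≤n+o⇒m∸n≤o (rk ed ⊤) (rk ed K) (begin
      rk ed ⊤            ≤⟨ ℕP.m∸n≡0⇒m≤n (full K′ n≤|K′|+j) ⟩
      rk ed K′           ≤⟨ rk-K′≤1+rk-K ⟩
      suc (rk ed K)      ≡⟨ ℕP.+-comm 1 (rk ed K) ⟩
      rk ed K ℕ.+ 1      ∎)
    where
    open ℕP.≤-Reasoning
    n≤|K′|+j : n ≤ ∣ K′ ∣ ℕ.+ j
    n≤|K′|+j = subst (n ≤_) (trans (ℕP.+-suc ∣ K ∣ j) (cong (ℕ._+ j) (sym |K′|≡1+|K|))) n≤|K|+1+j

  full-rank-step : ∀ {j} → IsZeroPoly (f n ed m (suc j)) → FullRankFrom j → FullRankFrom (suc j)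
  full-rank-step {j} f≡0 full K n≤|K|+1+j with n ℕP.≤? ∣ K ∣ ℕ.+ j | corank K ℕ.≟ 0
  ... | yes n≤|K|+j | _       = full K n≤|K|+j
  ... | no _        | yes c≡0 = c≡0
  ... | no n≰|K|+j  | no c≢0  =
    contradiction (sym (f≡0 1)) (ℚP.<⇒≢ (f-coeff-pos 0<m (suc j) 1 off-diagonal K K-level corank≡1))
    where
    K-level : ∣ K ∣ ℕ.+ suc j ≡ n
    K-level = ℕP.≤-antisym (subst (_≤ n) (sym (ℕP.+-suc ∣ K ∣ j)) (ℕP.≰⇒> n≰|K|+j)) n≤|K|+1+j
    corank≡1 : corank K ≡ 1
    corank≡1 = ℕP.≤-antisym (corank-≤1 full K n≤|K|+1+j) (ℕP.n≢0⇒n>0 c≢0)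
    off-diagonal : ∀ J K′ → ∣ J ∣ ℕ.+ suc j ≡ n → J ⊆ K′ → ∣ J ∣ < ∣ K′ ∣ → corank K′ ≢ 1
    off-diagonal J K′ J-level _ |J|<|K′| c≡1 = ℕP.0≢1+n (trans (sym (full K′ n≤|K′|+j)) c≡1)
      where
      n≤|K′|+j : n ≤ ∣ K′ ∣ ℕ.+ j
      n≤|K′|+j = subst (_≤ ∣ K′ ∣ ℕ.+ j) (trans (sym (ℕP.+-suc ∣ J ∣ j)) J-level) (ℕP.+-monoˡ-≤ j |J|<|K′|)

  full-rank-below : ∀ i → (∀ j → 0 < j → j < suc i → IsZeroPoly (f n ed m j)) → FullRankFrom i
  full-rank-below zero    _         = full-rank-top
  full-rank-below (suc i) vanishing =
    full-rank-step (vanishing (suc i) (s≤s z≤n) ℕP.≤-refl)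
                   (full-rank-below i (λ j 0<j j<1+i → vanishing j 0<j (ℕP.m<n⇒m<1+n j<1+i)))

corollary3p9 : (k n : ℕ) (G : Matrix k n) →
    (∀ (j : Fin n) → ∃ λ (i : Fin k) → G i j ≢ + 0) →
    (ed : Subset n → List ℕ) →
    (∀ (J : Subset n) → IsSmithForm (subMat G J) (ed J)) →
    (m : ℕ) → 1 ≤ m → m ≤ ρ₀ n ed →
    (i : ℕ) → 0 < i → ¬ IsZeroPoly (f n ed m i) →
    (∀ (j : ℕ) → 0 < j → j < i → IsZeroPoly (f n ed m j)) →
    DegLe1 (f n ed m i)
corollary3p9 k n G _ ed smith m 1≤m _ (suc i) _ _ lower-vanish d 2≤d =
  f-coeff-vanishes (suc i) d corank-small
  where
  open Coefficients ed m
  open FullRank G ed smith 1≤m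
  corank-small : ∀ J K → ∣ J ∣ ℕ.+ suc i ≡ n → J ⊆ K → corank K ≢ d
  corank-small J K J-level J⊆K =
    ℕP.<⇒≢ (ℕP.≤-<-trans (corank-≤1 (full-rank-below i lower-vanish) K n≤|K|+1+i) 2≤d)
    where
    n≤|K|+1+i : n ≤ ∣ K ∣ ℕ.+ suc i
    n≤|K|+1+i = subst (_≤ ∣ K ∣ ℕ.+ suc i) J-level (ℕP.+-monoˡ-≤ (suc i) (p⊆q⇒∣p∣≤∣q∣ J⊆K))
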